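{- Let $r\ge 1$ and let $G$ be a subgraph of the strong product $P_r\boxtimes P_r$ such that $(G,W)$, with $W=(\omega_1,\omega_2)$, is a realization of $S\subset\mathbb{Z}^2$ satisfying $r(u\vert W)=u$ for every vertex $u\in V(G)=S$. Let $u=(u_1,u_2)\in S$. If $u_1>0$, then at least one vertex of $A=\{(u_1-1,u_2-1),(u_1-1,u_2),(u_1-1,u_2+1)\}$ belongs to $S$ and is adjacent to $u$ in $G$. If $u_2>0$, then at least one vertex of $B=\{(u_1-1,u_2-1),(u_1,u_2-1),(u_1+1,u_2-1)\}$ belongs to $S$ and is adjacent to $u$ in $G$.
   Context: All graphs are finite, simple and connected; $d$ is the shortest-path distance. $P_r$ is the path on $\{0,\dots,r-1\}$ with edges $\{i-1,i\}$; $P_r\boxtimes P_r$ has vertex set $\{0,\dots,r-1\}^2$ with $x,y$ adjacent iff $\max(\vert x_1-y_1\vert,\vert x_2-y_2\vert)=1$. For $W=(\omega_1,\omega_2)$, $r(u\vert W)=(d(u,\omega_1),d(u,\omega_2))$. $(G,W)$ is a realization of $S$ if $r(\cdot\vert W)$ is injective on $V(G)$ with image $S$. -}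

module Defs where

open import Data.Nat using (ℕ; zero; suc; _+_; _≤_; _<_)
open import Data.Product using (_×_; _,_; Σ; ∃; proj₁; proj₂)
open import Data.Sum using (_⊎_)
open import Relation.Binary.PropositionalEquality using (_≡_)
open import Level using (0ℓ)

-- Vertices of P_r ⊠ P_r are pairs (x₁ , x₂) of naturals with x₁ , x₂ < r.
Pt : Set
Pt = ℕ × ℕ

Adj1 : ℕ → ℕ → Set
Adj1 a b = suc a ≡ b ⊎ suc b ≡ a

Close : ℕ → ℕ → Set
Close a b = a ≡ b ⊎ Adj1 a b

StrongAdj : Pt → Pt → Set
StrongAdj x y =
  (Adj1 (proj₁ x) (proj₁ y) × Close (proj₂ x) (proj₂ y))
  ⊎ (Close (proj₁ x) (proj₁ y) × Adj1 (proj₂ x) (proj₂ y))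

InBox : ℕ → Pt → Set
InBox r x = proj₁ x < r × proj₂ x < r

-- A subgraph G of P_r ⊠ P_r: a vertex set V ⊆ {0..r-1}² and a symmetric
-- edge relation E ⊆ V × V contained in the strong-product adjacency.
-- (Simplicity: no loops, since StrongAdj is irreflexive.)
record SubStrong (r : ℕ) : Set₁ where
  field
    V      : Pt → Set
    E      : Pt → Pt → Set
    V-box  : ∀ x → V x → InBox r x
    E-sym  : ∀ x y → E x y → E y x
    E-V    : ∀ x y → E x y → V x × V y
    E-sub  : ∀ x y → E x y → StrongAdj x y

open SubStrong public

data Walk {r : ℕ} (G : SubStrong r) : Pt → Pt → ℕ → Set where
  nil  : ∀ {x} → V G x → Walk G x x 0
  cons : ∀ {x y z n} → E G x y → Walk G y z n → Walk G x z (suc n)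

Connected : ∀ {r} → SubStrong r → Set
Connected G = ∀ x y → V G x → V G y → ∃ λ n → Walk G x y n

IsDist : ∀ {r} → SubStrong r → Pt → Pt → ℕ → Set
IsDist G x y k = Walk G x y k × (∀ m → Walk G x y m → k ≤ m)

Rep : ∀ {r} → SubStrong r → Pt → Pt → Pt → Pt → Set
Rep G ω₁ ω₂ u s = IsDist G u ω₁ (proj₁ s) × IsDist G u ω₂ (proj₂ s)

Realization : ∀ {r} → SubStrong r → Pt → Pt → (Pt → Set) → Set
Realization G ω₁ ω₂ S =
  (V G ω₁ × V G ω₂)
  × (∀ u → V G u → Σ Pt λ s → Rep G ω₁ ω₂ u s × S s)
  × (∀ u v s → V G u → V G v → Rep G ω₁ ω₂ u s → Rep G ω₁ ω₂ v s → u ≡ v)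
  × (∀ s → S s → Σ Pt λ u → V G u × Rep G ω₁ ω₂ u s)

InA : Pt → Pt → Set
InA u v = suc (proj₁ v) ≡ proj₁ u × Close (proj₂ v) (proj₂ u)

InB : Pt → Pt → Set
InB u v = Close (proj₁ v) (proj₁ u) × suc (proj₂ v) ≡ proj₂ u

module Submission where

-- Since r(u | W) = u, the i-th coordinate of a vertex is its distance to ωᵢ.
-- The first edge of a shortest walk from u to ωᵢ therefore leads to a
-- neighbour whose i-th coordinate is exactly one less, and strong-product
-- adjacency keeps the other coordinate within one of u's.

open import Defs
open import Data.Nat using (ℕ; suc; _≤_; _<_; s≤s⁻¹)
open import Data.Nat.Properties using (≤-antisym)
open import Data.Product using (_×_; _,_; Σ; proj₁; proj₂)
open import Data.Sum using (inj₁; inj₂)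
open import Relation.Binary.PropositionalEquality using (_≡_; cong)

DistanceTo : ∀ {r} → SubStrong r → Pt → (Pt → ℕ) → Set
DistanceTo G ω f = ∀ w → V G w → IsDist G w ω (f w)

closer-neighbour : ∀ {r} (G : SubStrong r) {ω : Pt} {f : Pt → ℕ} → DistanceTo G ω f
  → ∀ {u} → V G u → 0 < f u
  → Σ Pt λ v → suc (f v) ≡ f u × V G v × E G u v
closer-neighbour G {f = f} dist {u} u∈V 0<fu
  with f u | dist u u∈V | 0<fu
... | suc n | cons {y = v} u~v v⇝ω , shortest | _ =
  v , cong suc (≤-antisym fv≤n n≤fv) , v∈V , u~v
  where
  v∈V : V G v
  v∈V = proj₂ (E-V G u v u~v)

  fv≤n : f v ≤ n
  fv≤n = proj₂ (dist v v∈V) n v⇝ω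

  n≤fv : n ≤ f v
  n≤fv = s≤s⁻¹ (shortest (suc (f v)) (cons u~v (proj₁ (dist v v∈V))))

adj1⇒close : ∀ {a b} → Adj1 a b → Close a b
adj1⇒close = inj₂

strongAdj⇒close₁ : ∀ {x y} → StrongAdj x y → Close (proj₁ x) (proj₁ y)
strongAdj⇒close₁ (inj₁ (a , _)) = adj1⇒close a
strongAdj⇒close₁ (inj₂ (c , _)) = c

strongAdj⇒close₂ : ∀ {x y} → StrongAdj x y → Close (proj₂ x) (proj₂ y)
strongAdj⇒close₂ (inj₁ (_ , c)) = c
strongAdj⇒close₂ (inj₂ (_ , a)) = adj1⇒close a

edge⇒strongAdj : ∀ {r} (G : SubStrong r) {u v} → E G u v → StrongAdj v u
edge⇒strongAdj G {u} {v} u~v = E-sub G v u (E-sym G u v u~v)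

lemma12 : (r : ℕ) → 1 ≤ r → (G : SubStrong r) → Connected G → (ω₁ ω₂ : Pt)
    → Realization G ω₁ ω₂ (V G)
    → (∀ u → V G u → Rep G ω₁ ω₂ u u)
    → (u : Pt) → V G u
    → (0 < proj₁ u → Σ Pt λ v → InA u v × V G v × E G u v)
    × (0 < proj₂ u → Σ Pt λ v → InB u v × V G v × E G u v)
lemma12 r _ G _ ω₁ ω₂ _ rep u u∈V = neighbourInA , neighbourInB
  where
  neighbourInA : 0 < proj₁ u → Σ Pt λ v → InA u v × V G v × E G u v
  neighbourInA 0<u₁ =
    let v , v₁+1≡u₁ , v∈V , u~v =
          closer-neighbour G (λ w w∈V → proj₁ (rep w w∈V)) u∈V 0<u₁
    in v , (v₁+1≡u₁ , strongAdj⇒close₂ (edge⇒strongAdj G u~v)) , v∈V , u~v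

  neighbourInB : 0 < proj₂ u → Σ Pt λ v → InB u v × V G v × E G u v
  neighbourInB 0<u₂ =
    let v , v₂+1≡u₂ , v∈V , u~v =
          closer-neighbour G (λ w w∈V → proj₂ (rep w w∈V)) u∈V 0<u₂
    in v , (strongAdj⇒close₁ (edge⇒strongAdj G u~v) , v₂+1≡u₂) , v∈V , u~v
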